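{- Let $G$, $\Delta$, $\epsilon$, $q$, $\phi$, $x$, $y$, $\beta$ be as in the context, let $0<\gamma<\epsilon$, and consider a single run of the main loop of the Random Fan procedure on input $(\phi,xy,x,\beta)$ which performs at least $t$ iterations, so that the vertices $y_0=y,y_1,\dots,y_{t-1}$ are defined. Define $B_1=M(\phi,y_0)\setminus(\{\beta\}\cup M(\phi,x))$, and for $2\le i\le t$, $B_i=M(\phi,y_{i-1})\setminus\big(\{\beta\}\cup M(\phi,x)\cup\bigcup_{j=0}^{i-2}M(\phi,y_j)\big)$; $G_1=M(\phi,y_0)\setminus(\{\beta\}\cup B_1)$ and $G_i=M(\phi,y_{i-1})\setminus B_i$ for $i\ge2$; and $Z_i=1$ if $|G_i|<\gamma\Delta$, $Z_i=0$ otherwise. Then \[\sum_{i=1}^t Z_i\le \frac{1+\epsilon}{\epsilon-\gamma}.\]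
   Context: Let $G=(V,E)$ be a finite simple graph of maximum degree $\Delta\ge 2$, let $0<\epsilon<1$ with $\Delta\ge 1/\epsilon$, and let $q=(1+\epsilon)\Delta$, assumed to be an integer; $[q]=\{1,\dots,q\}$. A partial coloring is $\phi\colon E\to[q]\cup\{\mathsf{blank}\}$; proper means distinct colored edges sharing an endpoint have distinct colors. $M(\phi,v)=[q]\setminus\{\phi(vw):vw\in E\}$ is the set of colors missing at $v$ (sets like $\{\beta\}$ with $\beta=\mathsf{blank}$ remove nothing from sets of colors). RandomColor$(\phi,v,\theta)$: repeatedly choose $\eta\in[q]$ uniformly and independently until $\eta\ne\theta$ and $\eta\in M(\phi,v)$; return $\eta$. Fix a proper partial coloring $\phi$, an uncolored edge $xy$, $\beta\in M(\phi,y)\cup\{\mathsf{blank}\}$, and a positive integer $k_{\max}$. A run of the main loop of the Random Fan procedure on input $(\phi,xy,x,\beta)$: set $y_0=y$, $k=0$, $\theta=\beta$; while $k<k_{\max}$: let $\eta=$RandomColor$(\phi,y_k,\theta)$, set $\theta=\mathsf{blank}$; if $\eta\in M(\phi,x)$ or $\eta=\beta$ or $\eta\in M(\phi,y_{j-1})$ for some $1\le j\le k$, stop; otherwise set $k\leftarrow k+1$ and let $y_k$ be the unique neighbor of $x$ with $\phi(xy_k)=\eta$. Each pass through the body of the while loop is one iteration; iteration $i$ (for $i\ge1$) uses the vertex $y_{i-1}$.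
   Formalization: The parameter γ ranges over the rationals. -}

module Defs where

open import Data.Nat using (ℕ; zero; suc; _+_; _∸_; _≤_; _<_)
open import Data.Bool using (Bool; true; false; _∧_; not)
open import Data.Fin using (Fin; _≟_)
open import Data.Fin.Subset using (Subset; ⊥; ⁅_⁆; _∪_; _─_; ∣_∣; _∈_; _∉_)
open import Data.Maybe using (Maybe; just; nothing; maybe)
open import Data.List using (allFin)
open import Data.Bool.ListAction using (any)
open import Data.Vec using (tabulate)
open import Data.Product using (Σ; ∃; _×_; _,_)
open import Data.Integer using (+_)
open import Data.Rational using (ℚ; _/_; _<?_)
open import Relation.Nullary using (¬_)
open import Relation.Nullary.Decidable using (⌊_⌋)
open import Relation.Binary.PropositionalEquality using (_≡_; _≢_)

record Graph (n : ℕ) : Set where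
  field
    adj   : Fin n → Fin n → Bool
    sym   : ∀ u v → adj u v ≡ adj v u
    irrefl : ∀ v → adj v v ≡ false
open Graph public

Adj : ∀ {n} → Graph n → Fin n → Fin n → Set
Adj G u v = adj G u v ≡ true

deg : ∀ {n} → Graph n → Fin n → ℕ
deg G v = ∣ tabulate (adj G v) ∣

MaxDegree : ∀ {n} → Graph n → ℕ → Set
MaxDegree G Δ = (∀ v → deg G v ≤ Δ) × (∃ λ v → deg G v ≡ Δ)

ℕtoℚ : ℕ → ℚ
ℕtoℚ k = (+ k) / 1

-- A partial edge colouring with colours Fin q (= [q]) ; nothing = blank.
-- It is a function on (ordered) vertex pairs, required to be symmetric so that
-- it is a function on edges; its values on non-edges are never used.
Coloring : ℕ → ℕ → Set
Coloring n q = Fin n → Fin n → Maybe (Fin q)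

IsEdgeColoring : ∀ {n q} → Coloring n q → Set
IsEdgeColoring φ = ∀ u v → φ u v ≡ φ v u

Proper : ∀ {n q} → Graph n → Coloring n q → Set
Proper G φ = ∀ v u w c → Adj G v u → Adj G v w → u ≢ w →
             φ v u ≡ just c → φ v w ≢ just c

isColor : ∀ {q} → Maybe (Fin q) → Fin q → Bool
isColor nothing  c = false
isColor (just d) c = ⌊ d ≟ c ⌋

M : ∀ {n q} → Graph n → Coloring n q → Fin n → Subset q
M {n} G φ v = tabulate λ c → not (any (λ w → adj G v w ∧ isColor (φ v w) c) (allFin n))

blankSet : ∀ {q} → Maybe (Fin q) → Subset q
blankSet β = maybe ⁅_⁆ ⊥ β

_∈'_ : ∀ {q} → Fin q → Maybe (Fin q) → Set
c ∈' β = β ≡ just c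

UM : ∀ {n q} → Graph n → Coloring n q → (ℕ → Fin n) → ℕ → Subset q
UM G φ ys zero    = ⊥
UM G φ ys (suc k) = UM G φ ys k ∪ M G φ (ys k)

B : ∀ {n q} → Graph n → Coloring n q → Fin n → Maybe (Fin q) → (ℕ → Fin n) → ℕ → Subset q
B G φ x β ys i = M G φ (ys (i ∸ 1)) ─ ((blankSet β ∪ M G φ x) ∪ UM G φ ys (i ∸ 1))

Gs : ∀ {n q} → Graph n → Coloring n q → Fin n → Maybe (Fin q) → (ℕ → Fin n) → ℕ → Subset q
Gs G φ x β ys zero          = ⊥   -- unused
Gs G φ x β ys (suc zero)    = M G φ (ys 0) ─ (blankSet β ∪ B G φ x β ys 1)
Gs G φ x β ys (suc (suc k)) = M G φ (ys (suc k)) ─ B G φ x β ys (suc (suc k))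

Z : ∀ {n q} → Graph n → Coloring n q → Fin n → Maybe (Fin q) → (ℕ → Fin n) →
    ℚ → ℕ → ℕ → ℕ
Z G φ x β ys γ Δ i with ℕtoℚ ∣ Gs G φ x β ys i ∣ <? γ Data.Rational.* ℕtoℚ Δ
... | Relation.Nullary.yes _ = 1
... | Relation.Nullary.no  _ = 0

sumZ : ∀ {n q} → Graph n → Coloring n q → Fin n → Maybe (Fin q) → (ℕ → Fin n) →
       ℚ → ℕ → ℕ → ℕ
sumZ G φ x β ys γ Δ zero    = 0
sumZ G φ x β ys γ Δ (suc t) = sumZ G φ x β ys γ Δ t + Z G φ x β ys γ Δ (suc t)

-- A (partial) trace of a run of the main loop of Random Fan on (φ, xy, x, β)
-- with loop bound kmax that performs at least t iterations.
-- ys i = y_i (for i < t), η i = colour returned by RandomColor in iteration i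
-- (for 1 ≤ i ≤ t-1; these iterations did not stop).
RunTrace : ∀ {n q} → Graph n → Coloring n q → Fin n → Fin n → Maybe (Fin q) →
           ℕ → ℕ → (ℕ → Fin n) → (ℕ → Fin q) → Set
RunTrace G φ x y β kmax t ys η =
  (ys 0 ≡ y) ×
  (t ≤ kmax) ×   -- iteration t is entered: k = t-1 < kmax
  (∀ i → 1 ≤ i → i < t →
      -- RandomColor(φ, y_{i-1}, θ) returned η_i : η_i ∈ M(φ,y_{i-1}), η_i ≠ θ
      (η i ∈ M G φ (ys (i ∸ 1))) ×
      (i ≡ 1 → ¬ (η i ∈' β)) ×
      -- the stopping test failed
      (η i ∉ M G φ x) ×
      ¬ (η i ∈' β) ×
      (∀ j → 1 ≤ j → j ≤ i ∸ 1 → η i ∉ M G φ (ys (j ∸ 1))) ×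
      Adj G x (ys i) × (φ x (ys i) ≡ just (η i)))

{-# OPTIONS --safe #-}
-- Every colour set M(φ,v) has at least q − Δ = εΔ elements. The sets B_i are pairwise
-- disjoint and disjoint from M(φ,x), so |M(φ,x)| + Σ|B_i| ≤ q and hence Σ|B_i| ≤ Δ.
-- On the other hand G_i and B_i cover M(φ,y_{i-1}) (up to β when i = 1), so whenever
-- Z_i = 1 we get |B_i| > (ε − γ)Δ, or |B_1| + 1 > (ε − γ)Δ for i = 1. Summing,
-- (Σ Z_i)(ε − γ)Δ ≤ Δ + 1 ≤ (1 + ε)Δ.
module Submission where

open import Defs hiding (sym)
open import Data.Bool using (Bool; true; false; _∨_; _∧_; not)
open import Data.Bool.ListAction using (any)
open import Data.Fin using (Fin; zero; suc; _≟_)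
open import Data.Fin.Subset using (Subset; ⊥; ⁅_⁆; _∪_; _─_; ∁; ∣_∣; inside; outside; _∈_)
open import Data.Fin.Subset.Properties
  using (∣⊥∣≡0; ∣⁅x⁆∣≡1; ∣p∣≤n; ∣p∣≤∣p∪q∣; ∣p─q∣≤∣p∣; ∣∁p∣≡n∸∣p∣; ∪-assoc; p─q─r≡p─q∪r; p─q─r≡p─r─q)
import Data.List as List
open import Data.Maybe using (Maybe; just; nothing)
open import Data.Nat using (ℕ; zero; suc; z≤n; s≤s)
import Data.Nat as Nat
open import Data.Product using (_×_; _,_)
open import Data.Sum using (_⊎_; inj₁; inj₂)
open import Data.Vec using ([]; _∷_; tabulate)
open import Data.Vec.Properties using (tabulate-cong; tabulate-∘)
open import Function using (_∘_)
open import Relation.Nullary using (yes; no)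
open import Relation.Nullary.Decidable using (⌊_⌋)
open import Relation.Binary.PropositionalEquality
  using (_≡_; refl; cong; cong₂; sym; trans; subst; subst₂)

module SubsetCardinality where
  open Nat using (_+_; _≤_)
  open import Data.Nat.Properties
    using (≤-reflexive; ≤-trans; +-suc; +-mono-≤; +-monoʳ-≤; n≤1+n; m≤n⇒m≤1+n; module ≤-Reasoning)

  tabulate-false≡⊥ : ∀ {m} → tabulate {n = m} (λ _ → false) ≡ ⊥
  tabulate-false≡⊥ {zero}  = refl
  tabulate-false≡⊥ {suc m} = cong (outside ∷_) tabulate-false≡⊥

  tabulate-≟≡⁅⁆ : ∀ {m} (d : Fin m) → tabulate (λ c → ⌊ d ≟ c ⌋) ≡ ⁅ d ⁆
  tabulate-≟≡⁅⁆ zero    = cong (inside ∷_) tabulate-false≡⊥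
  tabulate-≟≡⁅⁆ (suc d) =
    cong (outside ∷_) (trans (tabulate-cong (⌊suc≟suc⌋ d)) (tabulate-≟≡⁅⁆ d))
    where
    ⌊suc≟suc⌋ : ∀ {m} (d c : Fin m) → ⌊ suc d ≟ suc c ⌋ ≡ ⌊ d ≟ c ⌋
    ⌊suc≟suc⌋ d c with d ≟ c
    ... | yes _ = refl
    ... | no  _ = refl

  tabulate-∨ : ∀ {m} (f g : Fin m → Bool) → tabulate (λ c → f c ∨ g c) ≡ tabulate f ∪ tabulate g
  tabulate-∨ {zero}  f g = refl
  tabulate-∨ {suc m} f g = cong ((f zero ∨ g zero) ∷_) (tabulate-∨ (f ∘ suc) (g ∘ suc))

  ∣p∪q∣≤∣p∣+∣q∣ : ∀ {m} (p q : Subset m) → ∣ p ∪ q ∣ ≤ ∣ p ∣ + ∣ q ∣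
  ∣p∪q∣≤∣p∣+∣q∣ []            []            = z≤n
  ∣p∪q∣≤∣p∣+∣q∣ (outside ∷ p) (outside ∷ q) = ∣p∪q∣≤∣p∣+∣q∣ p q
  ∣p∪q∣≤∣p∣+∣q∣ (outside ∷ p) (inside  ∷ q) =
    subst (suc ∣ p ∪ q ∣ ≤_) (sym (+-suc ∣ p ∣ ∣ q ∣)) (s≤s (∣p∪q∣≤∣p∣+∣q∣ p q))
  ∣p∪q∣≤∣p∣+∣q∣ (inside  ∷ p) (outside ∷ q) = s≤s (∣p∪q∣≤∣p∣+∣q∣ p q)
  ∣p∪q∣≤∣p∣+∣q∣ (inside  ∷ p) (inside  ∷ q) =
    s≤s (≤-trans (∣p∪q∣≤∣p∣+∣q∣ p q) (+-monoʳ-≤ ∣ p ∣ (n≤1+n ∣ q ∣)))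

  ∣p∣≤∣p─q∣+∣q∣ : ∀ {m} (p q : Subset m) → ∣ p ∣ ≤ ∣ p ─ q ∣ + ∣ q ∣
  ∣p∣≤∣p─q∣+∣q∣ []            []            = z≤n
  ∣p∣≤∣p─q∣+∣q∣ (outside ∷ p) (outside ∷ q) = ∣p∣≤∣p─q∣+∣q∣ p q
  ∣p∣≤∣p─q∣+∣q∣ (outside ∷ p) (inside  ∷ q) =
    subst (∣ p ∣ ≤_) (sym (+-suc ∣ p ─ q ∣ ∣ q ∣)) (m≤n⇒m≤1+n (∣p∣≤∣p─q∣+∣q∣ p q))
  ∣p∣≤∣p─q∣+∣q∣ (inside  ∷ p) (outside ∷ q) = s≤s (∣p∣≤∣p─q∣+∣q∣ p q)
  ∣p∣≤∣p─q∣+∣q∣ (inside  ∷ p) (inside  ∷ q) =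
    subst (suc ∣ p ∣ ≤_) (sym (+-suc ∣ p ─ q ∣ ∣ q ∣)) (s≤s (∣p∣≤∣p─q∣+∣q∣ p q))

  ∣p∪q∣≡∣p∣+∣q─p∣ : ∀ {m} (p q : Subset m) → ∣ p ∪ q ∣ ≡ ∣ p ∣ + ∣ q ─ p ∣
  ∣p∪q∣≡∣p∣+∣q─p∣ []            []            = refl
  ∣p∪q∣≡∣p∣+∣q─p∣ (outside ∷ p) (outside ∷ q) = ∣p∪q∣≡∣p∣+∣q─p∣ p q
  ∣p∪q∣≡∣p∣+∣q─p∣ (outside ∷ p) (inside  ∷ q) =
    trans (cong suc (∣p∪q∣≡∣p∣+∣q─p∣ p q)) (sym (+-suc ∣ p ∣ ∣ q ─ p ∣))
  ∣p∪q∣≡∣p∣+∣q─p∣ (inside  ∷ p) (outside ∷ q) = cong suc (∣p∪q∣≡∣p∣+∣q─p∣ p q)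
  ∣p∪q∣≡∣p∣+∣q─p∣ (inside  ∷ p) (inside  ∷ q) = cong suc (∣p∪q∣≡∣p∣+∣q─p∣ p q)

  ∣p─q∪r∣≤∣p─r∣ : ∀ {m} (p q r : Subset m) → ∣ p ─ (q ∪ r) ∣ ≤ ∣ p ─ r ∣
  ∣p─q∪r∣≤∣p─r∣ p q r = subst (λ s → ∣ s ∣ ≤ ∣ p ─ r ∣)
    (trans (p─q─r≡p─r─q p r q) (p─q─r≡p─q∪r p q r)) (∣p─q∣≤∣p∣ (p ─ r) q)

  -- The left-hand set is the union of the sets S a, over the a = g i with b a, each of size ≤ 1.
  ∣any-∧∣≤∣b∣ : ∀ {A : Set} {k m} (g : Fin k → A) (b : A → Bool) (S : A → Fin m → Bool) →
    (∀ a → ∣ tabulate (S a) ∣ ≤ 1) →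
    ∣ tabulate (λ c → any (λ a → b a ∧ S a c) (List.tabulate g)) ∣ ≤ ∣ tabulate (b ∘ g) ∣
  ∣any-∧∣≤∣b∣ {k = zero} {m} _ _ _ _ =
    ≤-reflexive (trans (cong ∣_∣ (tabulate-false≡⊥ {m})) (∣⊥∣≡0 m))
  ∣any-∧∣≤∣b∣ {k = suc k} {m} g b S ∣S∣≤1 = begin
    ∣ tabulate (λ c → first b₀ c ∨ rest c) ∣        ≡⟨ cong ∣_∣ (tabulate-∨ (first b₀) rest) ⟩
    ∣ tabulate (first b₀) ∪ tabulate rest ∣         ≤⟨ ∣p∪q∣≤∣p∣+∣q∣ (tabulate (first b₀)) (tabulate rest) ⟩
    ∣ tabulate (first b₀) ∣ + ∣ tabulate rest ∣     ≤⟨ first+rest b₀ ⟩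
    ∣ tabulate (b ∘ g) ∣                            ∎
    where
    open ≤-Reasoning
    b₀ = b (g zero)
    first : Bool → Fin m → Bool
    first b′ c = b′ ∧ S (g zero) c
    rest : Fin m → Bool
    rest c = any (λ a → b a ∧ S a c) (List.tabulate (g ∘ suc))
    ∣rest∣≤ : ∣ tabulate rest ∣ ≤ ∣ tabulate (b ∘ g ∘ suc) ∣
    ∣rest∣≤ = ∣any-∧∣≤∣b∣ (g ∘ suc) b S ∣S∣≤1
    first+rest : ∀ b′ → ∣ tabulate (first b′) ∣ + ∣ tabulate rest ∣ ≤ ∣ b′ ∷ tabulate (b ∘ g ∘ suc) ∣
    first+rest true  = +-mono-≤ (∣S∣≤1 (g zero)) ∣rest∣≤
    first+rest false rewrite tabulate-false≡⊥ {m} | ∣⊥∣≡0 m = ∣rest∣≤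

  ∣isColor∣≤1 : ∀ {m} (c : Maybe (Fin m)) → ∣ tabulate (isColor c) ∣ ≤ 1
  ∣isColor∣≤1 {m} nothing = subst (_≤ 1) (sym (trans (cong ∣_∣ (tabulate-false≡⊥ {m})) (∣⊥∣≡0 m))) z≤n
  ∣isColor∣≤1 (just d)    = ≤-reflexive (trans (cong ∣_∣ (tabulate-≟≡⁅⁆ d)) (∣⁅x⁆∣≡1 d))

  ∣blankSet∣≤1 : ∀ {m} (β : Maybe (Fin m)) → ∣ blankSet β ∣ ≤ 1
  ∣blankSet∣≤1 {m} nothing = subst (_≤ 1) (sym (∣⊥∣≡0 m)) z≤n
  ∣blankSet∣≤1 (just c)    = ≤-reflexive (∣⁅x⁆∣≡1 c)

open SubsetCardinality

module MissingColours {n q} (G : Graph n) (φ : Coloring n q) where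
  open Nat using (_+_; _∸_; _≤_)
  open import Data.Nat.Properties using (+-comm; +-monoʳ-≤; m≤n+m∸n; module ≤-Reasoning)
  open ≤-Reasoning

  coloursAt : Fin n → Subset q
  coloursAt v = tabulate (λ c → any (λ w → adj G v w ∧ isColor (φ v w) c) (List.allFin n))

  M≡∁coloursAt : ∀ v → M G φ v ≡ ∁ (coloursAt v)
  M≡∁coloursAt v = tabulate-∘ not (λ c → any (λ w → adj G v w ∧ isColor (φ v w) c) (List.allFin n))

  ∣coloursAt∣≤deg : ∀ v → ∣ coloursAt v ∣ ≤ deg G v
  ∣coloursAt∣≤deg v =
    ∣any-∧∣≤∣b∣ (λ w → w) (adj G v) (λ w → isColor (φ v w)) (λ w → ∣isColor∣≤1 (φ v w))

  q≤∣M∣+deg : ∀ v → q ≤ ∣ M G φ v ∣ + deg G v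
  q≤∣M∣+deg v = begin
    q                       ≤⟨ m≤n+m∸n q ∣ P ∣ ⟩
    ∣ P ∣ + (q ∸ ∣ P ∣)     ≡⟨ +-comm ∣ P ∣ _ ⟩
    (q ∸ ∣ P ∣) + ∣ P ∣     ≡⟨ cong (_+ ∣ P ∣) ∣M∣≡q∸∣P∣ ⟨
    ∣ M G φ v ∣ + ∣ P ∣     ≤⟨ +-monoʳ-≤ ∣ M G φ v ∣ (∣coloursAt∣≤deg v) ⟩
    ∣ M G φ v ∣ + deg G v   ∎
    where
    P = coloursAt v
    ∣M∣≡q∸∣P∣ : ∣ M G φ v ∣ ≡ q ∸ ∣ P ∣
    ∣M∣≡q∸∣P∣ = trans (cong ∣_∣ (M≡∁coloursAt v)) (∣∁p∣≡n∸∣p∣ P)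

module FanSets {n q} (G : Graph n) (φ : Coloring n q) (x : Fin n) (β : Maybe (Fin q))
               (ys : ℕ → Fin n) {Δ} (deg≤Δ : ∀ v → deg G v Nat.≤ Δ) where
  open Nat using (_+_; _≤_)
  open import Data.Nat.Properties
    using (≤-trans; +-assoc; +-identityʳ; +-monoˡ-≤; +-monoʳ-≤; +-cancelˡ-≤; module ≤-Reasoning)
  open ≤-Reasoning
  open MissingColours G φ

  q≤∣M∣+Δ : ∀ v → q ≤ ∣ M G φ v ∣ + Δ
  q≤∣M∣+Δ v = ≤-trans (q≤∣M∣+deg v) (+-monoʳ-≤ ∣ M G φ v ∣ (deg≤Δ v))

  ∑∣B∣ : ℕ → ℕ
  ∑∣B∣ zero    = 0
  ∑∣B∣ (suc t) = ∑∣B∣ t + ∣ B G φ x β ys (suc t) ∣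

  ∣M∣+∑∣B∣≤∣M∪UM∣ : ∀ t → ∣ M G φ x ∣ + ∑∣B∣ t ≤ ∣ M G φ x ∪ UM G φ ys t ∣
  ∣M∣+∑∣B∣≤∣M∪UM∣ zero =
    subst (_≤ ∣ M G φ x ∪ ⊥ ∣) (sym (+-identityʳ ∣ M G φ x ∣)) (∣p∣≤∣p∪q∣ (M G φ x) ⊥)
  ∣M∣+∑∣B∣≤∣M∪UM∣ (suc t) = begin
    ∣ Mx ∣ + (∑∣B∣ t + ∣ Bₜ ∣)     ≡⟨ +-assoc ∣ Mx ∣ (∑∣B∣ t) _ ⟨
    ∣ Mx ∣ + ∑∣B∣ t + ∣ Bₜ ∣       ≤⟨ +-monoˡ-≤ ∣ Bₜ ∣ (∣M∣+∑∣B∣≤∣M∪UM∣ t) ⟩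
    ∣ Mx ∪ U ∣ + ∣ Bₜ ∣            ≡⟨ cong (λ s → ∣ Mx ∪ U ∣ + ∣ Mₜ ─ s ∣) (∪-assoc X Mx U) ⟩
    ∣ Mx ∪ U ∣ + ∣ Mₜ ─ (X ∪ (Mx ∪ U)) ∣ ≤⟨ +-monoʳ-≤ ∣ Mx ∪ U ∣ (∣p─q∪r∣≤∣p─r∣ Mₜ X (Mx ∪ U)) ⟩
    ∣ Mx ∪ U ∣ + ∣ Mₜ ─ (Mx ∪ U) ∣ ≡⟨ ∣p∪q∣≡∣p∣+∣q─p∣ (Mx ∪ U) Mₜ ⟨
    ∣ (Mx ∪ U) ∪ Mₜ ∣              ≡⟨ cong ∣_∣ (∪-assoc Mx U Mₜ) ⟩
    ∣ Mx ∪ UM G φ ys (suc t) ∣     ∎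
    where
    X  = blankSet β
    Mx = M G φ x
    U  = UM G φ ys t
    Mₜ = M G φ (ys t)
    Bₜ = B G φ x β ys (suc t)

  ∑∣B∣≤Δ : ∀ t → ∑∣B∣ t ≤ Δ
  ∑∣B∣≤Δ t = +-cancelˡ-≤ ∣ M G φ x ∣ (∑∣B∣ t) Δ (begin
    ∣ M G φ x ∣ + ∑∣B∣ t         ≤⟨ ∣M∣+∑∣B∣≤∣M∪UM∣ t ⟩
    ∣ M G φ x ∪ UM G φ ys t ∣    ≤⟨ ∣p∣≤n (M G φ x ∪ UM G φ ys t) ⟩
    q                            ≤⟨ q≤∣M∣+Δ x ⟩
    ∣ M G φ x ∣ + Δ              ∎)

  q≤∣G₁∣+1+∣B₁∣+Δ : q ≤ ∣ Gs G φ x β ys 1 ∣ + (1 + ∣ B G φ x β ys 1 ∣) + Δ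
  q≤∣G₁∣+1+∣B₁∣+Δ = ≤-trans (q≤∣M∣+Δ (ys 0)) (+-monoˡ-≤ Δ (begin
    ∣ M₀ ∣                               ≤⟨ ∣p∣≤∣p─q∣+∣q∣ M₀ (blankSet β ∪ B₁) ⟩
    ∣ G₁ ∣ + ∣ blankSet β ∪ B₁ ∣          ≤⟨ +-monoʳ-≤ ∣ G₁ ∣ (∣p∪q∣≤∣p∣+∣q∣ (blankSet β) B₁) ⟩
    ∣ G₁ ∣ + (∣ blankSet β ∣ + ∣ B₁ ∣)    ≤⟨ +-monoʳ-≤ ∣ G₁ ∣ (+-monoˡ-≤ ∣ B₁ ∣ (∣blankSet∣≤1 β)) ⟩
    ∣ G₁ ∣ + (1 + ∣ B₁ ∣)                 ∎))
    where
    M₀ = M G φ (ys 0)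
    B₁ = B G φ x β ys 1
    G₁ = Gs G φ x β ys 1

  q≤∣Gᵢ∣+∣Bᵢ∣+Δ : ∀ k → q ≤ ∣ Gs G φ x β ys (2 + k) ∣ + ∣ B G φ x β ys (2 + k) ∣ + Δ
  q≤∣Gᵢ∣+∣Bᵢ∣+Δ k = ≤-trans (q≤∣M∣+Δ (ys (suc k)))
    (+-monoˡ-≤ Δ (∣p∣≤∣p─q∣+∣q∣ (M G φ (ys (suc k))) (B G φ x β ys (2 + k))))

-- From here on _+_, _≤_, _<_ are the rational operations.
open import Data.Integer as ℤ using (+_; +≤+; +<+)
import Data.Integer.Properties as ℤ
open import Data.Rational using (ℚ; 0ℚ; 1ℚ; _+_; _-_; _*_; _<_; _≤_; -_; _<?_; toℚᵘ; positive)
open import Data.Rational.Properties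
  using ( toℚᵘ-injective; toℚᵘ-fromℚᵘ; toℚᵘ-homo-+; toℚᵘ-cancel-≤; toℚᵘ-cancel-<
        ; +-mono-≤; +-monoˡ-≤; +-monoˡ-<; <⇒≤; *-assoc; *-zeroˡ; *-identityˡ; *-distribʳ-+
        ; *-cancelʳ-≤-pos; module ≤-Reasoning)
open import Data.Rational.Unnormalised as ℚᵘ using (ℚᵘ; mkℚᵘ; _≃_; *≡*; *≤*; *<*)
import Data.Rational.Unnormalised.Properties as ℚᵘ
open import Data.Rational.Solver using (module +-*-Solver)

-- ℕtoℚ k is definitionally fromℚᵘ (ℕtoℚᵘ k).
ℕtoℚᵘ : ℕ → ℚᵘ
ℕtoℚᵘ k = mkℚᵘ (+ k) 0

toℚᵘ-ℕtoℚ : ∀ k → toℚᵘ (ℕtoℚ k) ≃ ℕtoℚᵘ k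
toℚᵘ-ℕtoℚ k = toℚᵘ-fromℚᵘ (ℕtoℚᵘ k)

ℕtoℚᵘ-+ : ∀ a b → ℕtoℚᵘ (a Nat.+ b) ≃ ℕtoℚᵘ a ℚᵘ.+ ℕtoℚᵘ b
ℕtoℚᵘ-+ a b = *≡* (trans (ℤ.*-identityʳ _) (trans (ℤ.pos-+ a b)
  (sym (trans (ℤ.*-identityʳ _) (cong₂ ℤ._+_ (ℤ.*-identityʳ (+ a)) (ℤ.*-identityʳ (+ b)))))))

ℕtoℚ-+ : ∀ a b → ℕtoℚ (a Nat.+ b) ≡ ℕtoℚ a + ℕtoℚ b
ℕtoℚ-+ a b = toℚᵘ-injective (begin
  toℚᵘ (ℕtoℚ (a Nat.+ b))           ≈⟨ toℚᵘ-ℕtoℚ (a Nat.+ b) ⟩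
  ℕtoℚᵘ (a Nat.+ b)                 ≈⟨ ℕtoℚᵘ-+ a b ⟩
  ℕtoℚᵘ a ℚᵘ.+ ℕtoℚᵘ b              ≈⟨ ℚᵘ.+-cong (toℚᵘ-ℕtoℚ a) (toℚᵘ-ℕtoℚ b) ⟨
  toℚᵘ (ℕtoℚ a) ℚᵘ.+ toℚᵘ (ℕtoℚ b)  ≈⟨ toℚᵘ-homo-+ (ℕtoℚ a) (ℕtoℚ b) ⟨
  toℚᵘ (ℕtoℚ a + ℕtoℚ b)            ∎)
  where open ℚᵘ.≃-Reasoning

ℕtoℚ-mono-≤ : ∀ {a b} → a Nat.≤ b → ℕtoℚ a ≤ ℕtoℚ b
ℕtoℚ-mono-≤ {a} {b} a≤b = toℚᵘ-cancel-≤
  (ℚᵘ.≤-respʳ-≃ (ℚᵘ.≃-sym (toℚᵘ-ℕtoℚ b)) (ℚᵘ.≤-respˡ-≃ (ℚᵘ.≃-sym (toℚᵘ-ℕtoℚ a))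
    (*≤* (subst₂ ℤ._≤_ (sym (ℤ.*-identityʳ _)) (sym (ℤ.*-identityʳ _)) (+≤+ a≤b)))))

ℕtoℚ-mono-< : ∀ {a b} → a Nat.< b → ℕtoℚ a < ℕtoℚ b
ℕtoℚ-mono-< {a} {b} a<b = toℚᵘ-cancel-<
  (ℚᵘ.<-respʳ-≃ (ℚᵘ.≃-sym (toℚᵘ-ℕtoℚ b)) (ℚᵘ.<-respˡ-≃ (ℚᵘ.≃-sym (toℚᵘ-ℕtoℚ a))
    (*<* (subst₂ ℤ._<_ (sym (ℤ.*-identityʳ _)) (sym (ℤ.*-identityʳ _)) (+<+ a<b)))))

[ε-γ]Δ<e : ∀ {Δ q g e} {ε γ} → (1ℚ + ε) * ℕtoℚ Δ ≡ ℕtoℚ q →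
           q Nat.≤ g Nat.+ e Nat.+ Δ → ℕtoℚ g < γ * ℕtoℚ Δ → (ε - γ) * ℕtoℚ Δ < ℕtoℚ e
[ε-γ]Δ<e {Δ} {q} {g} {e} {ε} {γ} q≡[1+ε]Δ q≤g+e+Δ g<γΔ = begin-strict
  (ε - γ) * D                 ≡⟨ split ε γ D ⟩
  (1ℚ + ε) * D - K            ≡⟨ cong (_- K) q≡[1+ε]Δ ⟩
  ℕtoℚ q - K                  ≤⟨ +-monoˡ-≤ (- K) (ℕtoℚ-mono-≤ q≤g+e+Δ) ⟩
  ℕtoℚ (g Nat.+ e Nat.+ Δ) - K ≡⟨ cong (_- K) (trans (ℕtoℚ-+ (g Nat.+ e) Δ) (cong (_+ D) (ℕtoℚ-+ g e))) ⟩
  ℕtoℚ g + ℕtoℚ e + D - K     <⟨ +-monoˡ-< (- K) (+-monoˡ-< D (+-monoˡ-< (ℕtoℚ e) g<γΔ)) ⟩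
  γ * D + ℕtoℚ e + D - K      ≡⟨ cancel γ D (ℕtoℚ e) ⟩
  ℕtoℚ e                      ∎
  where
  open ≤-Reasoning
  open +-*-Solver
  D = ℕtoℚ Δ
  K = γ * D + D
  split : ∀ ε γ D → (ε - γ) * D ≡ (1ℚ + ε) * D - (γ * D + D)
  split = solve 3 (λ ε γ D → (ε :- γ) :* D := (con 1ℚ :+ ε) :* D :- (γ :* D :+ D)) refl
  cancel : ∀ γ D e → γ * D + e + D - (γ * D + D) ≡ e
  cancel = solve 3 (λ γ D e → γ :* D :+ e :+ D :- (γ :* D :+ D) := e) refl

Z≡0⊎small : ∀ {n q} (G : Graph n) (φ : Coloring n q) x β ys γ Δ i →
  Z G φ x β ys γ Δ i ≡ 0 ⊎ (Z G φ x β ys γ Δ i ≡ 1 × ℕtoℚ ∣ Gs G φ x β ys i ∣ < γ * ℕtoℚ Δ)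
Z≡0⊎small G φ x β ys γ Δ i with ℕtoℚ ∣ Gs G φ x β ys i ∣ <? γ * ℕtoℚ Δ
... | yes small = inj₂ (refl , small)
... | no  _     = inj₁ refl

module ZBound {n q} (G : Graph n) (φ : Coloring n q) (x : Fin n) (β : Maybe (Fin q))
              (ys : ℕ → Fin n) {Δ} (deg≤Δ : ∀ v → deg G v Nat.≤ Δ)
              (ε γ : ℚ) (q≡[1+ε]Δ : (1ℚ + ε) * ℕtoℚ Δ ≡ ℕtoℚ q) where
  open FanSets G φ x β ys deg≤Δ
  open ≤-Reasoning

  gap : ℚ
  gap = (ε - γ) * ℕtoℚ Δ

  -- The naturals under ℕtoℚ are passed explicitly: Agda cannot infer them through ℕtoℚ.
  z*gap≤e : ∀ {z g} e → z ≡ 0 ⊎ (z ≡ 1 × ℕtoℚ g < γ * ℕtoℚ Δ) → q Nat.≤ g Nat.+ e Nat.+ Δ →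
            ℕtoℚ z * gap ≤ ℕtoℚ e
  z*gap≤e e (inj₁ refl) _ = subst (_≤ ℕtoℚ e) (sym (*-zeroˡ gap)) (ℕtoℚ-mono-≤ {0} {e} z≤n)
  z*gap≤e {g = g} e (inj₂ (refl , g<γΔ)) q≤g+e+Δ = subst (_≤ ℕtoℚ e) (sym (*-identityˡ gap))
    (<⇒≤ ([ε-γ]Δ<e {Δ} {q} {g} {e} {ε} {γ} q≡[1+ε]Δ q≤g+e+Δ g<γΔ))

  ∑Z*gap≤1+∑∣B∣ : ∀ t → ℕtoℚ (sumZ G φ x β ys γ Δ t) * gap ≤ ℕtoℚ (1 Nat.+ ∑∣B∣ t)
  ∑Z*gap≤1+∑∣B∣ zero          = subst (_≤ 1ℚ) (sym (*-zeroˡ gap)) (ℕtoℚ-mono-≤ {0} {1} z≤n)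
  ∑Z*gap≤1+∑∣B∣ (suc zero)    =
    z*gap≤e (1 Nat.+ ∣ B G φ x β ys 1 ∣) (Z≡0⊎small G φ x β ys γ Δ 1) q≤∣G₁∣+1+∣B₁∣+Δ
  ∑Z*gap≤1+∑∣B∣ (suc (suc k)) = begin
    ℕtoℚ (s Nat.+ z) * gap                ≡⟨ cong (_* gap) (ℕtoℚ-+ s z) ⟩
    (ℕtoℚ s + ℕtoℚ z) * gap               ≡⟨ *-distribʳ-+ gap (ℕtoℚ s) (ℕtoℚ z) ⟩
    ℕtoℚ s * gap + ℕtoℚ z * gap           ≤⟨ +-mono-≤ (∑Z*gap≤1+∑∣B∣ (suc k)) z*gap≤b ⟩
    ℕtoℚ (1 Nat.+ ∑∣B∣ (suc k)) + ℕtoℚ b  ≡⟨ ℕtoℚ-+ (1 Nat.+ ∑∣B∣ (suc k)) b ⟨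
    ℕtoℚ (1 Nat.+ ∑∣B∣ (2 Nat.+ k))       ∎
    where
    s = sumZ G φ x β ys γ Δ (suc k)
    z = Z G φ x β ys γ Δ (2 Nat.+ k)
    b = ∣ B G φ x β ys (2 Nat.+ k) ∣
    z*gap≤b : ℕtoℚ z * gap ≤ ℕtoℚ b
    z*gap≤b = z*gap≤e b (Z≡0⊎small G φ x β ys γ Δ (2 Nat.+ k)) (q≤∣Gᵢ∣+∣Bᵢ∣+Δ k)

  ∑Z*[ε-γ]≤1+ε : 1ℚ ≤ ε * ℕtoℚ Δ → 0 Nat.< Δ → ∀ t →
                 ℕtoℚ (sumZ G φ x β ys γ Δ t) * (ε - γ) ≤ 1ℚ + ε
  ∑Z*[ε-γ]≤1+ε 1≤εΔ 0<Δ t = *-cancelʳ-≤-pos D {{positive (ℕtoℚ-mono-< 0<Δ)}} (begin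
    ℕtoℚ s * (ε - γ) * D          ≡⟨ *-assoc (ℕtoℚ s) (ε - γ) D ⟩
    ℕtoℚ s * gap                  ≤⟨ ∑Z*gap≤1+∑∣B∣ t ⟩
    ℕtoℚ (1 Nat.+ ∑∣B∣ t)         ≤⟨ ℕtoℚ-mono-≤ {1 Nat.+ ∑∣B∣ t} {1 Nat.+ Δ} (s≤s (∑∣B∣≤Δ t)) ⟩
    ℕtoℚ (1 Nat.+ Δ)              ≡⟨ ℕtoℚ-+ 1 Δ ⟩
    1ℚ + D                        ≤⟨ +-monoˡ-≤ D 1≤εΔ ⟩
    ε * D + D                     ≡⟨ solve 2 (λ ε D → ε :* D :+ D := (con 1ℚ :+ ε) :* D) refl ε D ⟩
    (1ℚ + ε) * D                  ∎)
    where
    open +-*-Solver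
    D = ℕtoℚ Δ
    s = sumZ G φ x β ys γ Δ t

-- Only the degree bound, Δ > 0, 1 ≤ εΔ and q = (1 + ε)Δ are used: the bound holds for every
-- sequence ys, whether or not it comes from a run.
lemma5p3 : ∀ {n : ℕ} (G : Graph n) (Δ q : ℕ) (ε γ : ℚ) →
    2 Data.Nat.≤ Δ → MaxDegree G Δ →
    0ℚ < ε → ε < 1ℚ → 1ℚ ≤ ε * ℕtoℚ Δ →
    (1ℚ + ε) * ℕtoℚ Δ ≡ ℕtoℚ q →
    0ℚ < γ → γ < ε →
    (φ : Coloring n q) → IsEdgeColoring φ → Proper G φ →
    (x y : Fin n) → Adj G x y → φ x y ≡ nothing →
    (β : Maybe (Fin q)) → (β ≡ nothing ⊎ (∀ c → β ≡ just c → c ∈ M G φ y)) →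
    (kmax t : ℕ) → 1 Data.Nat.≤ kmax →
    (ys : ℕ → Fin n) (η : ℕ → Fin q) → RunTrace G φ x y β kmax t ys η →
    ℕtoℚ (sumZ G φ x β ys γ Δ t) * (ε - γ) ≤ 1ℚ + ε
lemma5p3 G Δ q ε γ (s≤s _) (deg≤Δ , _) _ _ 1≤εΔ q≡[1+ε]Δ _ _ φ _ _ x _ _ _ β _ _ t _ ys _ _ =
  ZBound.∑Z*[ε-γ]≤1+ε G φ x β ys deg≤Δ ε γ q≡[1+ε]Δ 1≤εΔ (s≤s z≤n) t
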